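{- Let $\lambda$ be a strict partition with $d$ parts, $B\in\mathrm{BS}(\lambda)$, and $j\ge0$ an integer such that columns $j$ and $j+1$ of $D(\lambda)$ have the same number of boxes. Then $B(i,j)<B(i,j+1)$ for all $i$ with $(i,j)\in D(\lambda)$.
   Context: For a strict partition $\lambda=(\lambda_1>\cdots>\lambda_d>0)$, the shifted diagram is $D(\lambda)=\{(i,j-d+i-1):1\le i\le d,1\le j\le\lambda_i\}$ (row $i$ occupies columns $i-d,\dots,\lambda_i-d+i-1$; rows are numbered top to bottom). $B(i,j)$ denotes the entry of box $(i,j)$. For $(i,j)\in D(\lambda)$ with $j\ge0$ the hook $H(i,j)$ is $(i,j)$ together with the boxes of row $i$ to its right and of column $j$ below it; for $(i,-j)$, $j>0$, $H(i,-j)$ is $(i,-j)$, the boxes of row $i$ to its right, the boxes of column $-j$ below it, and all boxes of row $d-j+1$. The extended filling $\tilde B$ of a filling $B$ additionally puts $B(i,0)$ in the box $(i,-(d+1-i))$ for $1\le i\le d$. Extended hook: $\tilde H(i,j)=H(i,j)$ for $j\ge0$, $\tilde H(i,-j)=H(i,-j)\cup\{(d+1-j,-j)\}$ for $j>0$. Rank: $\mathrm{rk}(i,j)=\lambda_i-d+i-j$ if $j\ge0$, $\mathrm{rk}(i,j)=\lambda_i-d+i+\lambda_{d+1+j}+j+1$ if $j<0$. A balanced shifted tableau ($B\in\mathrm{BS}(\lambda)$) is a filling of $D(\lambda)$ using each of $1,\dots,|\lambda|$ once such that for every $(i,j)\in D(\lambda)$ exactly $\mathrm{rk}(i,j)-1$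 boxes of $\tilde H(i,j)$ carry an entry of $\tilde B$ larger than $B(i,j)$ (i.e. $B(i,j)$ is the $\mathrm{rk}(i,j)$-th largest entry of $\tilde B$ over $\tilde H(i,j)$). -}

module Defs where

open import Data.Bool using (Bool; true; false; _∧_; _∨_; if_then_else_; T)
open import Data.Nat as ℕ using (ℕ; zero; suc)
open import Data.Integer as ℤ using (ℤ; +_; _-_; _≤_; _<_)
open import Data.List using (List; []; _∷_; length; map; filter; upTo; concatMap)
open import Data.Nat.ListAction using (sum)
open import Data.Product using (_×_; _,_; Σ; ∃)
open import Relation.Nullary using (does)
open import Relation.Binary.PropositionalEquality using (_≡_)

data StrictlyDecreasingPositive : List ℕ → Set where
  []  : StrictlyDecreasingPositive []
  one : ∀ {a} → 0 ℕ.< a → StrictlyDecreasingPositive (a ∷ [])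
  two : ∀ {a b l} → b ℕ.< a → StrictlyDecreasingPositive (b ∷ l) →
        StrictlyDecreasingPositive (a ∷ b ∷ l)

StrictPartition : List ℕ → Set
StrictPartition = StrictlyDecreasingPositive

nparts : List ℕ → ℕ
nparts = length

size : List ℕ → ℕ
size = sum

-- λ_i with 1-based index (0 outside 1..d)
part : List ℕ → ℕ → ℕ
part []      _             = 0
part (a ∷ l) 0             = 0
part (a ∷ l) 1             = a
part (a ∷ l) (suc (suc i)) = part l (suc i)

infix 4 _≤ᵇ_ _<ᵇ_ _==_ _<ⁿ_
_≤ᵇ_ : ℤ → ℤ → Bool
x ≤ᵇ y = does (x ℤ.≤? y)

_<ᵇ_ : ℤ → ℤ → Bool
x <ᵇ y = does (x ℤ.<? y)

_==_ : ℤ → ℤ → Bool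
x == y = does (x ℤ.≟ y)

_<ⁿ_ : ℕ → ℕ → Bool
x <ⁿ y = does (x ℕ.<? y)

-- A filling assigns a natural number to every position (row i : ℕ, column c : ℤ);
-- only values on boxes of D(λ) matter.
Filling : Set
Filling = ℕ → ℤ → ℕ

isRow : List ℕ → ℕ → Bool
isRow l i = (+ 1 ≤ᵇ + i) ∧ (+ i ≤ᵇ + nparts l)

inD : List ℕ → ℕ → ℤ → Bool
inD l i c = isRow l i ∧ ((+ i - + nparts l) ≤ᵇ c)
                      ∧ (c ≤ᵇ (((+ part l i - + nparts l) ℤ.+ + i) - + 1))

-- the extra box (i, -(d+1-i)) of the extended filling
inExt : List ℕ → ℕ → ℤ → Bool
inExt l i c = isRow l i ∧ (c == ((+ i - + nparts l) - + 1))

extend : List ℕ → Filling → Filling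
extend l B i c = if inExt l i c then B i (+ 0) else B i c

inExtHook : List ℕ → ℕ → ℤ → ℕ → ℤ → Bool
inExtHook l i j k c =
  let d = nparts l
      base = (inD l k c ∧ (+ k == + i) ∧ (j ≤ᵇ c))
           ∨ (inD l k c ∧ (c == j) ∧ (+ i ≤ᵇ + k))
      r = (+ d ℤ.+ + 1) ℤ.+ j
  in if + 0 ≤ᵇ j then base
     else base ∨ (inD l k c ∧ (+ k == r))
               ∨ ((+ k == r) ∧ (c == j))

rk : List ℕ → ℕ → ℤ → ℤ
rk l i j =
  let d = nparts l in
  if + 0 ≤ᵇ j then ((+ part l i - + d) ℤ.+ + i) - j
  else ((((+ part l i - + d) ℤ.+ + i) ℤ.+ + part l ℤ.∣ (+ d ℤ.+ + 1) ℤ.+ j ∣) ℤ.+ j) ℤ.+ + 1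

positions : List ℕ → List (ℕ × ℤ)
positions l =
  concatMap (λ i → map (λ t → (suc i , + t - + nparts l))
                       (upTo (suc (nparts l ℕ.+ size l))))
            (upTo (nparts l))

countWhere : List (ℕ × ℤ) → (ℕ → ℤ → Bool) → ℕ
countWhere []             P = 0
countWhere ((k , c) ∷ ps) P = (if P k c then 1 else 0) ℕ.+ countWhere ps P

largerInHook : List ℕ → Filling → ℕ → ℤ → ℕ
largerInHook l B i j =
  countWhere (positions l)
    (λ k c → inExtHook l i j k c ∧ (B i j <ⁿ extend l B k c))

IsStandardFilling : List ℕ → Filling → Set
IsStandardFilling l B =
    (∀ i c → T (inD l i c) → 1 ℕ.≤ B i c × B i c ℕ.≤ size l)
  × (∀ i c i' c' → T (inD l i c) → T (inD l i' c') → B i c ≡ B i' c' → (i ≡ i' × c ≡ c'))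
  × (∀ n → 1 ℕ.≤ n → n ℕ.≤ size l → Σ ℕ λ i → Σ ℤ λ c → T (inD l i c) × B i c ≡ n)

IsBalancedShifted : List ℕ → Filling → Set
IsBalancedShifted l B =
  IsStandardFilling l B ×
  (∀ i c → T (inD l i c) → + largerInHook l B i c ≡ rk l i c - + 1)

columnLength : List ℕ → ℤ → ℕ
columnLength l c = countWhere (positions l) (λ k c' → inD l k c' ∧ (c' == c))

module Submission where

-- Downward induction on the row i. Suppose B(i,j+1) < B(i,j) = x. For j ≥ 0 the extended hook
-- H̃(i,j) is the plain hook: row i from column j on, and column j below i. An entry of H(i,j)
-- exceeding x lies either in row i right of column j+1, hence in H(i,j+1) with entry > x > B(i,j+1),
-- or at some (k,j) with k > i. In the latter case (k,j+1) ∈ D(λ), since every row of column j+1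
-- also meets column j and the two columns have equal length, and B(k,j+1) > B(k,j) > x by
-- induction. So H(i,j+1) has at least as many entries above B(i,j+1) as H(i,j) has above x, whereas
-- balancedness together with rk(i,j) = rk(i,j+1) + 1 demands one more. Equality B(i,j) = B(i,j+1)
-- is excluded because B is injective on D(λ).

open import Defs
open import Algebra.Properties.CommutativeSemigroup using (interchange)
open import Data.Bool using (Bool; true; false; _∧_; if_then_else_; T)
open import Data.Bool.Properties using (T-∧; T-∨)
open import Data.Empty using (⊥; ⊥-elim)
open import Data.Integer as ℤ using (ℤ; +_; _-_)
import Data.Integer.Properties as ℤₚ
open import Data.Integer.Tactic.RingSolver using (solve-∀)
open import Data.List using (List; []; _∷_; _++_; map; concatMap; upTo; applyUpTo)
open import Data.List.Membership.Propositional using (_∈_)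
open import Data.List.Membership.Propositional.Properties using (∈-upTo⁺)
open import Data.List.Properties using (map-cong; map-upTo)
open import Data.List.Relation.Unary.Any using (here; there)
open import Data.Nat as ℕ using (ℕ; zero; suc; z≤n; s≤s; _<_)
open import Data.Nat.ListAction using (sum)
import Data.Nat.Properties as ℕₚ
open import Data.Product using (_×_; _,_; proj₁; proj₂; uncurry)
open import Data.Product.Function.NonDependent.Propositional using (_×-⇔_)
open import Data.Sum using (_⊎_; inj₁; inj₂)
open import Data.Sum.Function.Propositional using (_⊎-⇔_)
open import Function.Bundles using (_⇔_; mk⇔; Equivalence)
open import Function.Construct.Composition using (_⇔-∘_)
open import Function.Construct.Identity using (⇔-id)
open import Relation.Binary.Definitions using (tri<; tri≈; tri>)
open import Relation.Binary.PropositionalEquality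
open import Relation.Nullary using (Dec; yes; no; does; ¬_)
open import Relation.Nullary.Decidable using (T?; _×-dec_)

open Equivalence using (to; from)

T-does : ∀ {a} {A : Set a} (a? : Dec A) → T (does a?) ⇔ A
T-does (yes a) = mk⇔ (λ _ → a) (λ _ → _)
T-does (no ¬a) = mk⇔ (λ ()) ¬a

+-interchange : ∀ a b c d → (a ℕ.+ b) ℕ.+ (c ℕ.+ d) ≡ (a ℕ.+ c) ℕ.+ (b ℕ.+ d)
+-interchange = interchange ℕₚ.+-commutativeSemigroup

sum-map-mono : ∀ {A : Set} {f g : A → ℕ} → (∀ x → f x ℕ.≤ g x) → ∀ xs → sum (map f xs) ℕ.≤ sum (map g xs)
sum-map-mono f≤g []       = z≤n
sum-map-mono f≤g (x ∷ xs) = ℕₚ.+-mono-≤ (f≤g x) (sum-map-mono f≤g xs)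

+-≡-split : ∀ {a b c d} → a ℕ.≤ b → c ℕ.≤ d → a ℕ.+ c ≡ b ℕ.+ d → a ≡ b × c ≡ d
+-≡-split {a} {b} {c} {d} a≤b c≤d eq = a≡b , ℕₚ.+-cancelˡ-≡ b c d (trans (cong (ℕ._+ c) (sym a≡b)) eq)
  where
  b≤a : b ℕ.≤ a
  b≤a = ℕₚ.+-cancelʳ-≤ c b a (ℕₚ.≤-trans (ℕₚ.+-monoʳ-≤ b c≤d) (ℕₚ.≤-reflexive (sym eq)))
  a≡b : a ≡ b
  a≡b = ℕₚ.≤-antisym a≤b b≤a

sum-map-≡⇒≡ : ∀ {A : Set} {f g : A → ℕ} → (∀ x → f x ℕ.≤ g x) →
              ∀ {xs} → sum (map f xs) ≡ sum (map g xs) → ∀ {x} → x ∈ xs → f x ≡ g x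
sum-map-≡⇒≡ f≤g {y ∷ ys} eq (here refl) = proj₁ (+-≡-split (f≤g y) (sum-map-mono f≤g ys) eq)
sum-map-≡⇒≡ f≤g {y ∷ ys} eq (there x∈ys) =
  sum-map-≡⇒≡ f≤g (proj₂ (+-≡-split (f≤g y) (sum-map-mono f≤g ys) eq)) x∈ys

downwardInduction : ∀ {p} {P : ℕ → Set p} d → (∀ i → (∀ k → i < k → k ℕ.≤ d → P k) → P i) → ∀ i → P i
downwardInduction {P = P} d step i = go (suc (d ℕ.∸ i)) i ℕₚ.≤-refl
  where
  go : ∀ fuel i → d ℕ.∸ i < fuel → P i
  go (suc fuel) i d∸i<fuel = step i λ k i<k k≤d →
    go fuel k (ℕₚ.<-≤-trans (ℕₚ.∸-monoʳ-< i<k k≤d) (ℕ.s≤s⁻¹ d∸i<fuel))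

indicator : Bool → ℕ
indicator b = if b then 1 else 0

indicator-mono : ∀ {a b} → (T a → T b) → indicator a ℕ.≤ indicator b
indicator-mono {false}         _ = z≤n
indicator-mono {true} {true}   _ = ℕₚ.≤-refl
indicator-mono {true} {false} a⇒b = ⊥-elim (a⇒b _)

indicator-≡⇒T : ∀ {a b} → indicator a ≡ indicator b → T b → T a
indicator-≡⇒T {true}  {true} _ _ = _

indicator-≤-+ : ∀ {a b c} → (T a → T b ⊎ T c) → indicator a ℕ.≤ indicator b ℕ.+ indicator c
indicator-≤-+ {false}                   _ = z≤n
indicator-≤-+ {true} {true}             _ = s≤s z≤n
indicator-≤-+ {true} {false} {true}     _ = s≤s z≤n
indicator-≤-+ {true} {false} {false} a⇒b∨c with a⇒b∨c _
... | inj₁ ()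
... | inj₂ ()

indicator-+-≤ : ∀ {a b c} → (T b → T a) → (T c → T a) → (T b → T c → ⊥) →
                indicator b ℕ.+ indicator c ℕ.≤ indicator a
indicator-+-≤ {a} {true}  {true}  _   _   disj = ⊥-elim (disj _ _)
indicator-+-≤ {a} {true}  {false} b⇒a _   _    = indicator-mono b⇒a
indicator-+-≤ {a} {false} {c}     _   c⇒a _    = indicator-mono c⇒a

indicator-¬T : ∀ {b} → ¬ T b → indicator b ≡ 0
indicator-¬T {false} _ = refl
indicator-¬T {true}  ¬b = ⊥-elim (¬b _)

BoxPredicate : Set
BoxPredicate = ℕ → ℤ → Bool

countWhere-≤-+ : ∀ ps {P Q R : BoxPredicate} → (∀ k c → T (P k c) → T (Q k c) ⊎ T (R k c)) →
                 countWhere ps P ℕ.≤ countWhere ps Q ℕ.+ countWhere ps R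
countWhere-≤-+ []             _   = z≤n
countWhere-≤-+ ((k , c) ∷ ps) {P} {Q} {R} P⇒Q∨R = begin
  indicator (P k c) ℕ.+ countWhere ps P
    ≤⟨ ℕₚ.+-mono-≤ (indicator-≤-+ (P⇒Q∨R k c)) (countWhere-≤-+ ps P⇒Q∨R) ⟩
  (indicator (Q k c) ℕ.+ indicator (R k c)) ℕ.+ (countWhere ps Q ℕ.+ countWhere ps R)
    ≡⟨ +-interchange (indicator (Q k c)) (indicator (R k c)) (countWhere ps Q) (countWhere ps R) ⟩
  (indicator (Q k c) ℕ.+ countWhere ps Q) ℕ.+ (indicator (R k c) ℕ.+ countWhere ps R) ∎
  where open ℕₚ.≤-Reasoning

countWhere-+-≤ : ∀ ps {P Q R : BoxPredicate} →
                 (∀ k c → T (Q k c) → T (P k c)) → (∀ k c → T (R k c) → T (P k c)) →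
                 (∀ k c → T (Q k c) → T (R k c) → ⊥) →
                 countWhere ps Q ℕ.+ countWhere ps R ℕ.≤ countWhere ps P
countWhere-+-≤ []             _ _ _ = z≤n
countWhere-+-≤ ((k , c) ∷ ps) {P} {Q} {R} Q⇒P R⇒P disj = begin
  (indicator (Q k c) ℕ.+ countWhere ps Q) ℕ.+ (indicator (R k c) ℕ.+ countWhere ps R)
    ≡⟨ +-interchange (indicator (Q k c)) (countWhere ps Q) (indicator (R k c)) (countWhere ps R) ⟩
  (indicator (Q k c) ℕ.+ indicator (R k c)) ℕ.+ (countWhere ps Q ℕ.+ countWhere ps R)
    ≤⟨ ℕₚ.+-mono-≤ (indicator-+-≤ (Q⇒P k c) (R⇒P k c) (disj k c)) (countWhere-+-≤ ps Q⇒P R⇒P disj) ⟩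
  indicator (P k c) ℕ.+ countWhere ps P ∎
  where open ℕₚ.≤-Reasoning

countWhere-++ : ∀ ps qs (P : BoxPredicate) → countWhere (ps ++ qs) P ≡ countWhere ps P ℕ.+ countWhere qs P
countWhere-++ []             qs P = refl
countWhere-++ ((k , c) ∷ ps) qs P =
  trans (cong (indicator (P k c) ℕ.+_) (countWhere-++ ps qs P)) (sym (ℕₚ.+-assoc (indicator (P k c)) _ _))

countWhere-concatMap : ∀ {A : Set} (f : A → List (ℕ × ℤ)) xs (P : BoxPredicate) →
                       countWhere (concatMap f xs) P ≡ sum (map (λ x → countWhere (f x) P) xs)
countWhere-concatMap f []       P = refl
countWhere-concatMap f (x ∷ xs) P =
  trans (countWhere-++ (f x) (concatMap f xs) P) (cong (countWhere (f x) P ℕ.+_) (countWhere-concatMap f xs P))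

countWhere-applyUpTo-none : ∀ n (f : ℕ → ℕ × ℤ) (P : BoxPredicate) → (∀ t → ¬ T (uncurry P (f t))) →
                            countWhere (applyUpTo f n) P ≡ 0
countWhere-applyUpTo-none zero    f P none = refl
countWhere-applyUpTo-none (suc n) f P none =
  cong₂ ℕ._+_ (indicator-¬T (none 0)) (countWhere-applyUpTo-none n (λ t → f (suc t)) P (λ t → none (suc t)))

countWhere-applyUpTo-single : ∀ n (f : ℕ → ℕ × ℤ) (P : BoxPredicate) t₀ → t₀ < n →
                              (∀ t → T (uncurry P (f t)) → t ≡ t₀) →
                              countWhere (applyUpTo f n) P ≡ indicator (uncurry P (f t₀))
countWhere-applyUpTo-single (suc n) f P zero     _          only = begin
  indicator (uncurry P (f 0)) ℕ.+ countWhere (applyUpTo (λ t → f (suc t)) n) P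
    ≡⟨ cong (indicator (uncurry P (f 0)) ℕ.+_)
            (countWhere-applyUpTo-none n (λ t → f (suc t)) P (λ t p → ℕₚ.1+n≢0 (only (suc t) p))) ⟩
  indicator (uncurry P (f 0)) ℕ.+ 0
    ≡⟨ ℕₚ.+-identityʳ _ ⟩
  indicator (uncurry P (f 0)) ∎
  where open ≡-Reasoning
countWhere-applyUpTo-single (suc n) f P (suc t₀) (s≤s t₀<n) only =
  cong₂ ℕ._+_ (indicator-¬T (λ p → ℕₚ.0≢1+n (only 0 p)))
              (countWhere-applyUpTo-single n (λ t → f (suc t)) P t₀ t₀<n (λ t p → ℕₚ.suc-injective (only (suc t) p)))

-- positions l is definitionally concatMap (row l) (upTo (nparts l)).
row : List ℕ → ℕ → List (ℕ × ℤ)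
row l r = map (λ t → (suc r , + t - + nparts l)) (upTo (suc (nparts l ℕ.+ size l)))

countWhere-row : ∀ l r c (P : BoxPredicate) → c ℕ.≤ size l → (∀ k c′ → T (P k c′) → c′ ≡ + c) →
                 countWhere (row l r) P ≡ indicator (P (suc r) (+ c))
countWhere-row l r c P c≤size inColumn = begin
  countWhere (row l r) P
    ≡⟨ cong (λ ps → countWhere ps P) (map-upTo box (suc (d ℕ.+ size l))) ⟩
  countWhere (applyUpTo box (suc (d ℕ.+ size l))) P
    ≡⟨ countWhere-applyUpTo-single _ box P (c ℕ.+ d) c+d<width uniqueColumn ⟩
  indicator (P (suc r) (+ (c ℕ.+ d) - + d))
    ≡⟨ cong (λ c′ → indicator (P (suc r) c′)) (i+j-j≡i (+ c) (+ d)) ⟩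
  indicator (P (suc r) (+ c)) ∎
  where
  open ≡-Reasoning
  d = nparts l
  box : ℕ → ℕ × ℤ
  box t = (suc r , + t - + d)
  i+j-j≡i : ∀ a b → (a ℤ.+ b) - b ≡ a
  i+j-j≡i = solve-∀
  i-j+j≡i : ∀ a b → (a - b) ℤ.+ b ≡ a
  i-j+j≡i = solve-∀
  c+d<width : c ℕ.+ d < suc (d ℕ.+ size l)
  c+d<width = s≤s (subst (c ℕ.+ d ℕ.≤_) (ℕₚ.+-comm (size l) d) (ℕₚ.+-monoˡ-≤ d c≤size))
  uniqueColumn : ∀ t → T (P (suc r) (+ t - + d)) → t ≡ c ℕ.+ d
  uniqueColumn t p = ℤₚ.+-injective (begin
    + t                   ≡⟨ sym (i-j+j≡i (+ t) (+ d)) ⟩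
    (+ t - + d) ℤ.+ + d   ≡⟨ cong (ℤ._+ + d) (inColumn (suc r) _ p) ⟩
    + c ℤ.+ + d           ∎)

countWhere-column : ∀ l c (P : BoxPredicate) → c ℕ.≤ size l → (∀ k c′ → T (P k c′) → c′ ≡ + c) →
                    countWhere (positions l) P ≡ sum (map (λ r → indicator (P (suc r) (+ c))) (upTo (nparts l)))
countWhere-column l c P c≤size inColumn =
  trans (countWhere-concatMap (row l) (upTo (nparts l)) P)
        (cong sum (map-cong (λ r → countWhere-row l r c P c≤size inColumn) (upTo (nparts l))))

lastColumn : List ℕ → ℕ → ℤ
lastColumn l k = ((+ part l k - + nparts l) ℤ.+ + k) - + 1

T-inD : ∀ l k c → T (inD l k c) ⇔
        ((+ 1 ℤ.≤ + k × + k ℤ.≤ + nparts l) × (+ k - + nparts l ℤ.≤ c × c ℤ.≤ lastColumn l k))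
T-inD l k c =
  ((T-does (+ 1 ℤₚ.≤? + k) ×-⇔ T-does (+ k ℤₚ.≤? + nparts l)) ×-⇔
   (T-does (+ k - + nparts l ℤₚ.≤? c) ×-⇔ T-does (c ℤₚ.≤? lastColumn l k)))
  ⇔-∘ ((T-∧ ×-⇔ T-∧) ⇔-∘ T-∧)

inD⇒row : ∀ l k c → T (inD l k c) → 1 ℕ.≤ k × k ℕ.≤ nparts l
inD⇒row l k c h with to (T-inD l k c) h
... | (ℤ.+≤+ 1≤k , ℤ.+≤+ k≤d) , _ = 1≤k , k≤d

rowStart≤0 : ∀ l k c → T (inD l k c) → + k - + nparts l ℤ.≤ + 0
rowStart≤0 l k c h = ℤₚ.i≤j⇒i-j≤0 (ℤ.+≤+ (proj₂ (inD⇒row l k c h)))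

inD⇒<part : ∀ l k j → T (inD l k (+ j)) → j < part l k
inD⇒<part l k j h = ℤₚ.drop‿+<+ (ℤₚ.i≤pred[j]⇒i<j (begin
  + j                                     ≤⟨ proj₂ (proj₂ (to (T-inD l k (+ j)) h)) ⟩
  ((+ p - + d) ℤ.+ + k) - + 1             ≡⟨ regroup (+ p) (+ d) (+ k) ⟩
  (+ k - + d) ℤ.+ (+ p - + 1)             ≤⟨ ℤₚ.+-monoˡ-≤ (+ p - + 1) (rowStart≤0 l k (+ j) h) ⟩
  + 0 ℤ.+ (+ p - + 1)                     ≡⟨ ℤₚ.+-identityˡ (+ p - + 1) ⟩
  + p - + 1                               ≡⟨ ℤₚ.+-comm (+ p) ℤ.-1ℤ ⟩
  ℤ.pred (+ p)                            ∎))
  where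
  open ℤₚ.≤-Reasoning
  p = part l k
  d = nparts l
  regroup : ∀ a b c → ((a - b) ℤ.+ c) - + 1 ≡ (c - b) ℤ.+ (a - + 1)
  regroup = solve-∀

part≤size : ∀ l k → part l k ℕ.≤ size l
part≤size []      k             = z≤n
part≤size (a ∷ l) zero          = z≤n
part≤size (a ∷ l) (suc zero)    = ℕₚ.m≤m+n a (size l)
part≤size (a ∷ l) (suc (suc k)) = ℕₚ.≤-trans (part≤size l (suc k)) (ℕₚ.m≤n+m (size l) a)

inD⇒<size : ∀ l k j → T (inD l k (+ j)) → j < size l
inD⇒<size l k j h = ℕₚ.<-≤-trans (inD⇒<part l k j h) (part≤size l k)

inD-pred-column : ∀ l k j → T (inD l k (+ suc j)) → T (inD l k (+ j))
inD-pred-column l k j h with to (T-inD l k (+ suc j)) h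
... | isRow , (_ , suc-j≤last) = from (T-inD l k (+ j))
  (isRow , ℤₚ.≤-trans (rowStart≤0 l k (+ suc j) h) (ℤ.+≤+ z≤n) , ℤₚ.≤-trans (ℤ.+≤+ (ℕₚ.n≤1+n j)) suc-j≤last)

inD⇒extend≡ : ∀ l (B : Filling) k c → T (inD l k c) → extend l B k c ≡ B k c
inD⇒extend≡ l B k c h with inExt l k c in isExt
... | false = refl
... | true  = ⊥-elim (ℤₚ.<-irrefl refl (ℤₚ.i≤pred[j]⇒i<j (subst (start ℤ.≤_) c≡pred[start] start≤c)))
  where
  start = + k - + nparts l
  start≤c : start ℤ.≤ c
  start≤c = proj₁ (proj₂ (to (T-inD l k c) h))
  c≡pred[start] : c ≡ ℤ.pred start
  c≡pred[start] = trans (to (T-does (c ℤ.≟ start - + 1)) (proj₂ (to T-∧ (subst T (sym isExt) _))))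
                        (ℤₚ.+-comm start ℤ.-1ℤ)

HookBox : List ℕ → ℕ → ℕ → ℕ → ℤ → Set
HookBox l i j k c = (T (inD l k c) × + k ≡ + i × + j ℤ.≤ c) ⊎ (T (inD l k c) × c ≡ + j × + i ℤ.≤ + k)

hookBox⇒inD : ∀ l {i j k c} → HookBox l i j k c → T (inD l k c)
hookBox⇒inD l (inj₁ (h , _)) = h
hookBox⇒inD l (inj₂ (h , _)) = h

T-inExtHook : ∀ l i j k c → T (inExtHook l i (+ j) k c) ⇔ HookBox l i j k c
T-inExtHook l i j k c =
  (((⇔-id _ ×-⇔ (T-does (+ k ℤₚ.≟ + i) ×-⇔ T-does (+ j ℤₚ.≤? c))) ⇔-∘ ((⇔-id _ ×-⇔ T-∧) ⇔-∘ T-∧)) ⊎-⇔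
   ((⇔-id _ ×-⇔ (T-does (c ℤₚ.≟ + j) ×-⇔ T-does (+ i ℤₚ.≤? + k))) ⇔-∘ ((⇔-id _ ×-⇔ T-∧) ⇔-∘ T-∧)))
  ⇔-∘ T-∨

T-largerInHookBox : ∀ l (B : Filling) i j k c →
  T (inExtHook l i (+ j) k c ∧ (B i (+ j) <ⁿ extend l B k c)) ⇔ (HookBox l i j k c × B i (+ j) < B k c)
T-largerInHookBox l B i j k c = mk⇔ toBox fromBox
  where
  toBox : T (inExtHook l i (+ j) k c ∧ (B i (+ j) <ⁿ extend l B k c)) → HookBox l i j k c × B i (+ j) < B k c
  toBox p with to T-∧ p
  ... | inHook , larger with to (T-inExtHook l i j k c) inHook
  ... | box = box , subst (B i (+ j) <_) (inD⇒extend≡ l B k c (hookBox⇒inD l box))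
                          (to (T-does (B i (+ j) ℕₚ.<? extend l B k c)) larger)
  fromBox : HookBox l i j k c × B i (+ j) < B k c → T (inExtHook l i (+ j) k c ∧ (B i (+ j) <ⁿ extend l B k c))
  fromBox (box , larger) = from T-∧
    ( from (T-inExtHook l i j k c) box
    , from (T-does (B i (+ j) ℕₚ.<? extend l B k c))
           (subst (B i (+ j) <_) (sym (inD⇒extend≡ l B k c (hookBox⇒inD l box))) larger))

rk-suc : ∀ l i j → rk l i (+ suc j) ≡ ℤ.pred (rk l i (+ j))
rk-suc l i j = ℤₚ.minus-suc ((+ part l i - + nparts l) ℤ.+ + i) j

largerInHook-suc : ∀ l (B : Filling) → IsBalancedShifted l B → ∀ i j →
  T (inD l i (+ j)) → T (inD l i (+ suc j)) → largerInHook l B i (+ j) ≡ suc (largerInHook l B i (+ suc j))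
largerInHook-suc l B (_ , balanced) i j h h′ = ℤₚ.+-injective (begin
  + largerInHook l B i (+ j)                   ≡⟨ ℤₚ.suc-pred _ ⟨
  ℤ.suc (ℤ.pred (+ largerInHook l B i (+ j)))  ≡⟨ cong (λ n → ℤ.suc (ℤ.pred n)) (balanced i (+ j) h) ⟩
  ℤ.suc (ℤ.pred (rk l i (+ j) - + 1))          ≡⟨ cong ℤ.suc (ℤₚ.pred-+ (rk l i (+ j)) (ℤ.- + 1)) ⟨
  ℤ.suc (ℤ.pred (rk l i (+ j)) - + 1)          ≡⟨ cong (λ r → ℤ.suc (r - + 1)) (rk-suc l i j) ⟨
  ℤ.suc (rk l i (+ suc j) - + 1)               ≡⟨ cong ℤ.suc (balanced i (+ suc j) h′) ⟨
  ℤ.suc (+ largerInHook l B i (+ suc j))       ∎)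
  where open ≡-Reasoning

equalColumns⇒inD-suc : ∀ l j → columnLength l (+ j) ≡ columnLength l (+ suc j) →
                       ∀ k → T (inD l k (+ j)) → T (inD l k (+ suc j))
equalColumns⇒inD-suc l j equal zero h with () ← proj₁ (inD⇒row l zero (+ j) h)
equalColumns⇒inD-suc l j equal (suc r) h =
  proj₁ (to T-∧ (indicator-≡⇒T (sum-map-≡⇒≡ column-suc≤column sums-equal (∈-upTo⁺ r<d))
                                (from T-∧ (h , onColumn j))))
  where
  column : ℕ → BoxPredicate
  column c k c′ = inD l k c′ ∧ (c′ == + c)
  onColumn : ∀ c → T (+ c == + c)
  onColumn c = from (T-does (+ c ℤₚ.≟ + c)) refl
  inColumn : ∀ c k c′ → T (column c k c′) → c′ ≡ + c
  inColumn c k c′ p = to (T-does (c′ ℤₚ.≟ + c)) (proj₂ (to T-∧ p))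
  rowsOf : ℕ → ℕ → ℕ
  rowsOf c r′ = indicator (column c (suc r′) (+ c))
  r<d : r < nparts l
  r<d = proj₂ (inD⇒row l (suc r) (+ j) h)
  suc-j≤size : suc j ℕ.≤ size l
  suc-j≤size = inD⇒<size l (suc r) j h
  column-suc≤column : ∀ r′ → rowsOf (suc j) r′ ℕ.≤ rowsOf j r′
  column-suc≤column r′ = indicator-mono λ p →
    from T-∧ (inD-pred-column l (suc r′) j (proj₁ (to T-∧ p)) , onColumn j)
  sums-equal : sum (map (rowsOf (suc j)) (upTo (nparts l))) ≡ sum (map (rowsOf j) (upTo (nparts l)))
  sums-equal = begin
    sum (map (rowsOf (suc j)) (upTo (nparts l)))
      ≡⟨ countWhere-column l (suc j) (column (suc j)) suc-j≤size (inColumn (suc j)) ⟨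
    columnLength l (+ suc j)
      ≡⟨ equal ⟨
    columnLength l (+ j)
      ≡⟨ countWhere-column l j (column j) (ℕₚ.<⇒≤ suc-j≤size) (inColumn j) ⟩
    sum (map (rowsOf j) (upTo (nparts l))) ∎
    where open ≡-Reasoning

module HookComparison (l : List ℕ) (B : Filling) (i j : ℕ) where

  RowBox : ℕ → ℤ → Set
  RowBox k c = T (inD l k c) × + k ≡ + i × + suc j ℤ.≤ c × B i (+ j) < B k c

  ColumnBox : ℕ → ℕ → ℤ → Set
  ColumnBox c₀ k c = T (inD l k c) × c ≡ + c₀ × i < k × B i (+ j) < B k c

  rowBox? : ∀ k c → Dec (RowBox k c)
  rowBox? k c = T? (inD l k c) ×-dec + k ℤₚ.≟ + i ×-dec + suc j ℤₚ.≤? c ×-dec B i (+ j) ℕₚ.<? B k c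

  columnBox? : ∀ c₀ k c → Dec (ColumnBox c₀ k c)
  columnBox? c₀ k c = T? (inD l k c) ×-dec c ℤₚ.≟ + c₀ ×-dec i ℕₚ.<? k ×-dec B i (+ j) ℕₚ.<? B k c

  rowBox : BoxPredicate
  rowBox k c = does (rowBox? k c)

  columnBox : ℕ → BoxPredicate
  columnBox c₀ k c = does (columnBox? c₀ k c)

  module _ (next<this : B i (+ suc j) < B i (+ j)) where

    larger⇒rowBox⊎columnBox : ∀ k c → T (inExtHook l i (+ j) k c ∧ (B i (+ j) <ⁿ extend l B k c)) →
                              T (rowBox k c) ⊎ T (columnBox j k c)
    larger⇒rowBox⊎columnBox k c p with to (T-largerInHookBox l B i j k c) p
    ... | inj₁ (h , k≡i , j≤c) , larger with ℤₚ.+-injective k≡i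
    ...   | refl = inj₁ (from (T-does (rowBox? k c)) (h , k≡i , ℤₚ.i<j⇒suc[i]≤j j<c , larger))
      where
      j<c : + j ℤ.< c
      j<c = ℤₚ.≤∧≢⇒< j≤c λ { refl → ℕₚ.<-irrefl refl larger }
    larger⇒rowBox⊎columnBox k c p | inj₂ (h , refl , i≤k) , larger =
      inj₂ (from (T-does (columnBox? j k c)) (h , refl , i<k , larger))
      where
      i<k : i < k
      i<k = ℕₚ.≤∧≢⇒< (ℤₚ.drop‿+≤+ i≤k) λ { refl → ℕₚ.<-irrefl refl larger }

    rowBox⇒larger : ∀ k c → T (rowBox k c) → T (inExtHook l i (+ suc j) k c ∧ (B i (+ suc j) <ⁿ extend l B k c))
    rowBox⇒larger k c p with to (T-does (rowBox? k c)) p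
    ... | h , k≡i , suc-j≤c , larger =
      from (T-largerInHookBox l B i (suc j) k c) (inj₁ (h , k≡i , suc-j≤c) , ℕₚ.<-trans next<this larger)

    columnBox⇒larger : ∀ k c → T (columnBox (suc j) k c) → T (inExtHook l i (+ suc j) k c ∧ (B i (+ suc j) <ⁿ extend l B k c))
    columnBox⇒larger k c p with to (T-does (columnBox? (suc j) k c)) p
    ... | h , c≡suc-j , i<k , larger =
      from (T-largerInHookBox l B i (suc j) k c) (inj₂ (h , c≡suc-j , ℤ.+≤+ (ℕₚ.<⇒≤ i<k)) , ℕₚ.<-trans next<this larger)

  rowBox-columnBox-disjoint : ∀ c₀ k c → T (rowBox k c) → T (columnBox c₀ k c) → ⊥
  rowBox-columnBox-disjoint c₀ k c p q with ℤₚ.+-injective (proj₁ (proj₂ (to (T-does (rowBox? k c)) p)))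
  ... | refl = ℕₚ.<-irrefl refl (proj₁ (proj₂ (proj₂ (to (T-does (columnBox? c₀ k c)) q))))

  columnBox-count-mono :
    T (inD l i (+ j)) →
    (∀ k → T (inD l k (+ j)) → T (inD l k (+ suc j))) →
    (∀ k → i < k → T (inD l k (+ j)) → B k (+ j) < B k (+ suc j)) →
    countWhere (positions l) (columnBox j) ℕ.≤ countWhere (positions l) (columnBox (suc j))
  columnBox-count-mono h columnIncluded belowIncreasing = begin
    countWhere (positions l) (columnBox j)
      ≡⟨ countWhere-column l j (columnBox j) (ℕₚ.<⇒≤ suc-j≤size) (inColumn j) ⟩
    sum (map (λ r → indicator (columnBox j (suc r) (+ j))) (upTo (nparts l)))
      ≤⟨ sum-map-mono (λ r → indicator-mono (shift r)) (upTo (nparts l)) ⟩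
    sum (map (λ r → indicator (columnBox (suc j) (suc r) (+ suc j))) (upTo (nparts l)))
      ≡⟨ countWhere-column l (suc j) (columnBox (suc j)) suc-j≤size (inColumn (suc j)) ⟨
    countWhere (positions l) (columnBox (suc j)) ∎
    where
    open ℕₚ.≤-Reasoning
    suc-j≤size : suc j ℕ.≤ size l
    suc-j≤size = inD⇒<size l i j h
    inColumn : ∀ c₀ k c → T (columnBox c₀ k c) → c ≡ + c₀
    inColumn c₀ k c p = proj₁ (proj₂ (to (T-does (columnBox? c₀ k c)) p))
    shift : ∀ r → T (columnBox j (suc r) (+ j)) → T (columnBox (suc j) (suc r) (+ suc j))
    shift r p with to (T-does (columnBox? j (suc r) (+ j))) p
    ... | hk , _ , i<k , larger = from (T-does (columnBox? (suc j) (suc r) (+ suc j)))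
      (columnIncluded (suc r) hk , refl , i<k , ℕₚ.<-trans larger (belowIncreasing (suc r) i<k hk))

  largerInHook-≤-suc :
    B i (+ suc j) < B i (+ j) →
    T (inD l i (+ j)) →
    (∀ k → T (inD l k (+ j)) → T (inD l k (+ suc j))) →
    (∀ k → i < k → T (inD l k (+ j)) → B k (+ j) < B k (+ suc j)) →
    largerInHook l B i (+ j) ℕ.≤ largerInHook l B i (+ suc j)
  largerInHook-≤-suc next<this h columnIncluded belowIncreasing = begin
    largerInHook l B i (+ j)
      ≤⟨ countWhere-≤-+ (positions l) (larger⇒rowBox⊎columnBox next<this) ⟩
    countWhere (positions l) rowBox ℕ.+ countWhere (positions l) (columnBox j)
      ≤⟨ ℕₚ.+-monoʳ-≤ (countWhere (positions l) rowBox) (columnBox-count-mono h columnIncluded belowIncreasing) ⟩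
    countWhere (positions l) rowBox ℕ.+ countWhere (positions l) (columnBox (suc j))
      ≤⟨ countWhere-+-≤ (positions l) (rowBox⇒larger next<this) (columnBox⇒larger next<this)
                                      (rowBox-columnBox-disjoint (suc j)) ⟩
    largerInHook l B i (+ suc j) ∎
    where open ℕₚ.≤-Reasoning

increasing-from-rows-below :
  ∀ l (B : Filling) → IsBalancedShifted l B → ∀ j →
  (∀ k → T (inD l k (+ j)) → T (inD l k (+ suc j))) →
  ∀ i → T (inD l i (+ j)) →
  (∀ k → i < k → T (inD l k (+ j)) → B k (+ j) < B k (+ suc j)) →
  B i (+ j) < B i (+ suc j)
increasing-from-rows-below l B balanced@((_ , injective , _) , _) j columnIncluded i h below
  with ℕₚ.<-cmp (B i (+ j)) (B i (+ suc j))
... | tri< this<next _ _ = this<next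
... | tri≈ _ this≡next _ =
  ⊥-elim (ℤₚ.i≢suc[i] (proj₂ (injective i (+ j) i (+ suc j) h (columnIncluded i h) this≡next)))
... | tri> _ _ next<this =
  ⊥-elim (ℕₚ.1+n≰n (subst (ℕ._≤ largerInHook l B i (+ suc j))
                          (largerInHook-suc l B balanced i j h (columnIncluded i h))
                          (HookComparison.largerInHook-≤-suc l B i j next<this h columnIncluded below)))

lemma3p4 : (l : List ℕ) → StrictPartition l → (B : Filling) → IsBalancedShifted l B →
    (j : ℕ) → columnLength l (+ j) ≡ columnLength l (+ (suc j)) →
    ∀ i → T (inD l i (+ j)) → B i (+ j) < B i (+ (suc j))
lemma3p4 l _ B balanced j equal = downwardInduction (nparts l) λ i below h →
  increasing-from-rows-below l B balanced j (equalColumns⇒inD-suc l j equal) i h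
    λ k i<k hk → below k i<k (proj₂ (inD⇒row l k (+ j) hk)) hk
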